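{- Let $\Delta$ be a balanced $(d-1)$-dimensional simplicial complex on vertex set $V$ with a proper coloring $c:V\to[d]$. Let $\Delta^{(1)},\dots,\Delta^{(k)}$ be (not necessarily distinct) subcomplexes of $\Delta$, each of dimension at most $d-2$, on vertex sets $V^{(1)},\dots,V^{(k)}$, such that $c(V^{(i)})\neq[d]$ for every $i$. Let $v_1,\dots,v_k$ be distinct new vertices not in $V$ and let $(\Delta^{(j)})^c=\{F,\ F\cup\{v_j\}:F\in\Delta^{(j)}\}$ be the cone over $\Delta^{(j)}$ with apex $v_j$. Let $f=f(\Delta)$ and $f^{(j)}=f(\Delta^{(j)})$. Then $\Delta\cup\bigcup_{j=1}^k(\Delta^{(j)})^c$ is a balanced $(d-1)$-dimensional simplicial complex with $f$-vector $f+(0,f^{(1)}+\cdots+f^{(k)})$.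
   Context: A proper coloring $c:V\to[d]$ is a map injective on each face; a $(d-1)$-dimensional complex with a proper coloring into $[d]$ is balanced. The $f$-vector $(f_0,f_1,\dots)$ has $f_i$ equal to the number of faces with $i$ vertices, $f_0=1$. Vectors of different lengths are added coordinatewise after padding with zeros at the end. -}

module Defs where

open import Data.Nat using (ℕ; zero; suc; _+_; _≤_; _≡ᵇ_)
open import Data.Bool using (Bool; true; false; _∧_; _∨_; if_then_else_)
import Data.Bool as Bool
open import Data.Fin using (Fin)
open import Data.Fin.Subset using (Subset; ⊥; ⁅_⁆; _⊆_; _∈_; ∣_∣; inside; outside)
open import Data.Vec using (Vec; []; _∷_; take; drop)
open import Data.Vec.Properties using (≡-dec)
open import Data.List using (List; []; _∷_; _++_; map; allFin)
open import Data.Nat.ListAction using (sum)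
open import Data.Bool.ListAction using (any)
open import Data.Product using (Σ; _×_; ∃)
open import Relation.Binary.PropositionalEquality using (_≡_)
open import Relation.Nullary using (¬_)
open import Relation.Nullary.Decidable using (⌊_⌋)

-- A (finite) complex on the ambient vertex set Fin n, given by its
-- (decidable) membership predicate on faces F ⊆ Fin n.
Complex : ℕ → Set
Complex n = Subset n → Bool

_∈ᶜ_ : ∀ {n} → Subset n → Complex n → Set
F ∈ᶜ K = K F ≡ true

IsSimplicialComplex : ∀ {n} → Complex n → Set
IsSimplicialComplex {n} K =
  (⊥ ∈ᶜ K) × (∀ (F G : Subset n) → G ⊆ F → F ∈ᶜ K → G ∈ᶜ K)

IsSubcomplex : ∀ {n} → Complex n → Complex n → Set
IsSubcomplex {n} L K = IsSimplicialComplex L × (∀ (F : Subset n) → F ∈ᶜ L → F ∈ᶜ K)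

DimEqDMinus1 : ∀ {n} → Complex n → ℕ → Set
DimEqDMinus1 {n} K d =
  (∀ (F : Subset n) → F ∈ᶜ K → ∣ F ∣ ≤ d) × (∃ λ (F : Subset n) → F ∈ᶜ K × ∣ F ∣ ≡ d)

DimAtMostDMinus2 : ∀ {n} → Complex n → ℕ → Set
DimAtMostDMinus2 {n} K d = ∀ (F : Subset n) → F ∈ᶜ K → suc ∣ F ∣ ≤ d

IsProperColoring : ∀ {n d} → Complex n → (Fin n → Fin d) → Set
IsProperColoring {n} K c =
  ∀ (F : Subset n) → F ∈ᶜ K → ∀ (x y : Fin n) → x ∈ F → y ∈ F → c x ≡ c y → x ≡ y

IsBalanced : ∀ {n} → Complex n → ℕ → Set
IsBalanced {n} K d =
  IsSimplicialComplex K × DimEqDMinus1 K d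
    × Σ (Fin n → Fin d) (λ c → IsProperColoring K c)

_∈Vert_ : ∀ {n} → Fin n → Complex n → Set
v ∈Vert K = ⁅ v ⁆ ∈ᶜ K

ColorsAll : ∀ {n d} → Complex n → (Fin n → Fin d) → Set
ColorsAll {n} {d} L c = ∀ (a : Fin d) → ∃ λ (v : Fin n) → v ∈Vert L × c v ≡ a

allSubsets : (n : ℕ) → List (Subset n)
allSubsets zero = [] ∷ []
allSubsets (suc n) = map (inside ∷_) (allSubsets n) ++ map (outside ∷_) (allSubsets n)

-- f-vector, as an infinite (zero-padded) sequence: f K i = #faces with i vertices
fvec : ∀ {n} → Complex n → ℕ → ℕ
fvec {n} K i = sum (map (λ F → if K F ∧ (∣ F ∣ ≡ᵇ i) then 1 else 0) (allSubsets n))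

-- the vector (0, g): shift by one position
shift : (ℕ → ℕ) → ℕ → ℕ
shift g zero = 0
shift g (suc i) = g i

subsetEq : ∀ {m} → Subset m → Subset m → Bool
subsetEq A B = ⌊ ≡-dec Bool._≟_ A B ⌋

-- Ambient vertex set of the new complex: Fin (n + k); the first n are V,
-- vertex n + j (j : Fin k) is the new apex v_j.
-- Δ viewed as a complex on Fin (n + k)
liftC : ∀ {n} k → Complex n → Complex (n + k)
liftC {n} k K G = K (take n G) ∧ subsetEq (drop n G) ⊥

coneC : ∀ {n k} → Complex n → Fin k → Complex (n + k)
coneC {n} L j G = L (take n G) ∧ (subsetEq (drop n G) ⊥ ∨ subsetEq (drop n G) ⁅ j ⁆)

coneUnion : ∀ {n k} → Complex n → (Fin k → Complex n) → Complex (n + k)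
coneUnion {n} {k} K Ls G = liftC k K G ∨ any (λ j → coneC (Ls j) j G) (allFin k)

-- A face of the union splits as F ⊔ B with F ⊆ V and B ⊆ {v_1, …, v_k}; it is a face exactly when
-- B = ∅ and F ∈ Δ, or B = {v_j} and F ∈ Δ^(j) (using Δ^(j) ⊆ Δ). Everything is read off from this
-- description: closure under subsets and the dimension bound are immediate, giving the apex v_j a
-- color missing from Δ^(j) keeps the coloring proper, and when faces are counted by B only B = ∅
-- and the singletons contribute, the latter with one vertex more.
module Submission where

open import Defs
open import Data.Nat using (ℕ; zero; suc; _+_; _≤_; _≡ᵇ_; z≤n; s≤s)
open import Data.Nat.Properties using (≤-refl; ≤⇒≯; +-identityʳ; +-comm; +-commutativeSemigroup)
open import Algebra.Properties.CommutativeSemigroup +-commutativeSemigroup using (interchange; x∙yz≈y∙xz)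
open import Data.Bool using (Bool; true; false; T; _∧_; _∨_; if_then_else_)
import Data.Bool as Bool
open import Data.Bool.Properties using (T-≡; T-∧; T-∨; ∧-zeroʳ; ⇔→≡; ¬-not)
open import Data.Fin using (Fin; zero; suc; splitAt; join)
import Data.Fin as Fin
open import Data.Fin.Properties using (join-splitAt; any?; all?)
open import Data.Fin.Subset using (Subset; ⊥; ⁅_⁆; _⊆_; _∈_; ∣_∣; inside; outside)
open import Data.Fin.Subset.Properties using (∉⊥; x∈⁅y⁆⇒x≡y; x∈⁅x⁆; ∣⊥∣≡0; ∣⁅x⁆∣≡1; ⊆-antisym; Empty-unique; _∈?_)
open import Data.Vec using ([]; _∷_; take; drop; _++_; lookup)
open import Data.Vec.Properties using (take++drop≡id; ++-injectiveˡ; ++-injectiveʳ; lookup-splitAt; lookup-++ˡ; lookup-++ʳ; []=⇒lookup; lookup⇒[]=; ≡-dec)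
open import Data.List using ([]; _∷_; map; allFin) renaming (_++_ to _++ₗ_)
open import Data.List.Properties using (map-++; map-cong; map-∘; map-tabulate)
open import Data.List.Relation.Unary.Any.Properties using (any⁺; any⁻; tabulate⁺; tabulate⁻)
open import Data.Nat.ListAction using (sum)
open import Data.Nat.ListAction.Properties using (sum-++)
open import Data.Bool.ListAction using (any)
open import Data.Product using (_×_; ∃; _,_; proj₁; proj₂)
open import Data.Sum using (_⊎_; inj₁; inj₂; [_,_]′)
open import Data.Empty using (⊥-elim)
open import Function using (_∘_; id; Equivalence; mk⇔)
open import Relation.Binary.PropositionalEquality
open import Relation.Nullary using (¬_; Dec; yes; no; ¬?; contradiction)
open import Relation.Nullary.Decidable using (toWitness; fromWitness; decidable-stable; _×-dec_)

open Equivalence using (to; from)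

sum-map-zero : ∀ {A : Set} (f : A → ℕ) xs → (∀ x → f x ≡ 0) → sum (map f xs) ≡ 0
sum-map-zero f []       f≡0 = refl
sum-map-zero f (x ∷ xs) f≡0 = cong₂ _+_ (f≡0 x) (sum-map-zero f xs f≡0)

sum-map-+ : ∀ {A : Set} (f g : A → ℕ) xs →
            sum (map (λ x → f x + g x) xs) ≡ sum (map f xs) + sum (map g xs)
sum-map-+ f g []       = refl
sum-map-+ f g (x ∷ xs) = begin
  f x + g x + sum (map (λ x → f x + g x) xs)      ≡⟨ cong (f x + g x +_) (sum-map-+ f g xs) ⟩
  f x + g x + (sum (map f xs) + sum (map g xs))   ≡⟨ interchange (f x) (g x) _ _ ⟩
  f x + sum (map f xs) + (g x + sum (map g xs))   ∎
  where open ≡-Reasoning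

sum-map-swap : ∀ {A B : Set} (g : A → B → ℕ) xs ys →
               sum (map (λ x → sum (map (g x) ys)) xs) ≡ sum (map (λ y → sum (map (λ x → g x y) xs)) ys)
sum-map-swap g []       ys = sym (sum-map-zero _ ys (λ _ → refl))
sum-map-swap g (x ∷ xs) ys = begin
  sum (map (g x) ys) + sum (map (λ x → sum (map (g x) ys)) xs)
    ≡⟨ cong (sum (map (g x) ys) +_) (sum-map-swap g xs ys) ⟩
  sum (map (g x) ys) + sum (map (λ y → sum (map (λ x → g x y) xs)) ys)
    ≡⟨ sum-map-+ (g x) (λ y → sum (map (λ x → g x y) xs)) ys ⟨
  sum (map (λ y → g x y + sum (map (λ x → g x y) xs)) ys) ∎
  where open ≡-Reasoning

sum-map-shift : ∀ {A : Set} (g : A → ℕ → ℕ) xs i →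
                sum (map (λ x → shift (g x) i) xs) ≡ shift (λ m → sum (map (λ x → g x m) xs)) i
sum-map-shift g xs zero    = sum-map-zero _ xs (λ _ → refl)
sum-map-shift g xs (suc i) = refl

sum-allFin-suc : ∀ {k} (f : Fin (suc k) → ℕ) →
                 sum (map f (allFin (suc k))) ≡ f zero + sum (map (f ∘ suc) (allFin k))
sum-allFin-suc f = cong (λ xs → f zero + sum xs) (trans (map-tabulate suc f) (sym (map-tabulate id (f ∘ suc))))

∣++∣ : ∀ {m k} (A : Subset m) (B : Subset k) → ∣ A ++ B ∣ ≡ ∣ A ∣ + ∣ B ∣
∣++∣ []           B = refl
∣++∣ (inside ∷ A)  B = cong suc (∣++∣ A B)
∣++∣ (outside ∷ A) B = ∣++∣ A B

∣++⊥∣ : ∀ {m k} (A : Subset m) → ∣ A ++ ⊥ {k} ∣ ≡ ∣ A ∣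
∣++⊥∣ {k = k} A = trans (∣++∣ A ⊥) (trans (cong (∣ A ∣ +_) (∣⊥∣≡0 k)) (+-identityʳ ∣ A ∣))

∣++⁅⁆∣ : ∀ {m k} (A : Subset m) (j : Fin k) → ∣ A ++ ⁅ j ⁆ ∣ ≡ suc ∣ A ∣
∣++⁅⁆∣ A j = trans (∣++∣ A ⁅ j ⁆) (trans (cong (∣ A ∣ +_) (∣⁅x⁆∣≡1 j)) (+-comm ∣ A ∣ 1))

⊥++⊥ : ∀ m {k} → ⊥ {m} ++ ⊥ {k} ≡ ⊥
⊥++⊥ zero    = refl
⊥++⊥ (suc m) = cong (outside ∷_) (⊥++⊥ m)

∈-++⁻ : ∀ {m k} (A : Subset m) (B : Subset k) {x} →
        x ∈ A ++ B → [ _∈ A , _∈ B ]′ (splitAt m x)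
∈-++⁻ {m} A B {x} x∈ = on-side (splitAt m x) (trans (sym (lookup-splitAt m A B x)) ([]=⇒lookup x∈))
  where
  on-side : ∀ s → [ lookup A , lookup B ]′ s ≡ inside → [ _∈ A , _∈ B ]′ s
  on-side (inj₁ u) = lookup⇒[]= u A
  on-side (inj₂ w) = lookup⇒[]= w B

⊆-++⁻ : ∀ {m k} {A' A : Subset m} {B' B : Subset k} → A' ++ B' ⊆ A ++ B → A' ⊆ A × B' ⊆ B
⊆-++⁻ {m} {k} {A'} {A} {B'} {B} sub = A'⊆A , B'⊆B
  where
  A'⊆A : A' ⊆ A
  A'⊆A {u} u∈ = lookup⇒[]= u A (trans (sym (lookup-++ˡ A B u))
    ([]=⇒lookup (sub (lookup⇒[]= (u Fin.↑ˡ k) (A' ++ B') (trans (lookup-++ˡ A' B' u) ([]=⇒lookup u∈))))))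

  B'⊆B : B' ⊆ B
  B'⊆B {w} w∈ = lookup⇒[]= w B (trans (sym (lookup-++ʳ A B w))
    ([]=⇒lookup (sub (lookup⇒[]= (m Fin.↑ʳ w) (A' ++ B') (trans (lookup-++ʳ A' B' w) ([]=⇒lookup w∈))))))

⊆⊥⇒≡⊥ : ∀ {m} {B : Subset m} → B ⊆ ⊥ → B ≡ ⊥
⊆⊥⇒≡⊥ B⊆⊥ = Empty-unique (λ (x , x∈) → ∉⊥ (B⊆⊥ x∈))

⊆⁅x⁆⇒≡⊥⊎≡⁅x⁆ : ∀ {m} {B : Subset m} (x : Fin m) → B ⊆ ⁅ x ⁆ → B ≡ ⊥ ⊎ B ≡ ⁅ x ⁆
⊆⁅x⁆⇒≡⊥⊎≡⁅x⁆ {B = B} x B⊆⁅x⁆ with x ∈? B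
... | yes x∈B = inj₂ (⊆-antisym B⊆⁅x⁆ λ y∈ → subst (_∈ B) (sym (x∈⁅y⁆⇒x≡y x y∈)) x∈B)
... | no  x∉B = inj₁ (⊆⊥⇒≡⊥ λ {y} y∈ → contradiction (subst (_∈ B) (x∈⁅y⁆⇒x≡y x (B⊆⁅x⁆ y∈)) y∈) x∉B)

subsetEq⇒≡ : ∀ {m} {X Y : Subset m} → T (subsetEq X Y) → X ≡ Y
subsetEq⇒≡ {X = X} {Y} = toWitness {a? = ≡-dec Bool._≟_ X Y}

≡⇒subsetEq : ∀ {m} {X Y : Subset m} → X ≡ Y → T (subsetEq X Y)
≡⇒subsetEq {X = X} {Y} = fromWitness {a? = ≡-dec Bool._≟_ X Y}

take-++ : ∀ {m k} (A : Subset m) (B : Subset k) → take m (A ++ B) ≡ A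
take-++ {m} A B = ++-injectiveˡ _ A (take++drop≡id m (A ++ B))

drop-++ : ∀ {m k} (A : Subset m) (B : Subset k) → drop m (A ++ B) ≡ B
drop-++ {m} A B = ++-injectiveʳ _ A (take++drop≡id m (A ++ B))

∀-++ : ∀ {m k} (P : Subset (m + k) → Set) → (∀ A B → P (A ++ B)) → ∀ G → P G
∀-++ {m} P P-++ G = subst P (take++drop≡id m G) (P-++ (take m G) (drop m G))

Σ-subsets : ∀ {m} → (Subset m → ℕ) → ℕ
Σ-subsets {m} f = sum (map f (allSubsets m))

Σ-subsets-suc : ∀ {m} (f : Subset (suc m) → ℕ) →
                Σ-subsets f ≡ Σ-subsets (f ∘ (inside ∷_)) + Σ-subsets (f ∘ (outside ∷_))
Σ-subsets-suc {m} f = begin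
  sum (map f (map (inside ∷_) (allSubsets m) ++ₗ map (outside ∷_) (allSubsets m)))
    ≡⟨ cong sum (map-++ f (map (inside ∷_) (allSubsets m)) _) ⟩
  sum (map f (map (inside ∷_) (allSubsets m)) ++ₗ map f (map (outside ∷_) (allSubsets m)))
    ≡⟨ sum-++ (map f (map (inside ∷_) (allSubsets m))) _ ⟩
  sum (map f (map (inside ∷_) (allSubsets m))) + sum (map f (map (outside ∷_) (allSubsets m)))
    ≡⟨ cong₂ (λ xs ys → sum xs + sum ys) (map-∘ (allSubsets m)) (map-∘ (allSubsets m)) ⟨
  Σ-subsets (f ∘ (inside ∷_)) + Σ-subsets (f ∘ (outside ∷_)) ∎
  where open ≡-Reasoning

Σ-subsets-++ : ∀ m {k} (f : Subset (m + k) → ℕ) →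
               Σ-subsets f ≡ Σ-subsets (λ A → Σ-subsets {k} (λ B → f (A ++ B)))
Σ-subsets-++ zero    f = sym (+-identityʳ (Σ-subsets f))
Σ-subsets-++ (suc m) {k} f = trans (Σ-subsets-suc f)
  (trans (cong₂ _+_ (Σ-subsets-++ m (f ∘ (inside ∷_))) (Σ-subsets-++ m (f ∘ (outside ∷_))))
         (sym (Σ-subsets-suc {m} (λ A → Σ-subsets {k} (λ B → f (A ++ B))))))

Σ-subsets-size≤0 : ∀ {m} (f : Subset m → ℕ) → (∀ B → 1 ≤ ∣ B ∣ → f B ≡ 0) → Σ-subsets f ≡ f ⊥
Σ-subsets-size≤0 {zero}  f _ = +-identityʳ (f [])
Σ-subsets-size≤0 {suc m} f f-sparse = begin
  Σ-subsets f                                            ≡⟨ Σ-subsets-suc f ⟩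
  Σ-subsets (f ∘ (inside ∷_)) + Σ-subsets (f ∘ (outside ∷_))
    ≡⟨ cong₂ _+_ (sum-map-zero _ (allSubsets m) (λ B → f-sparse (inside ∷ B) (s≤s z≤n)))
                 (Σ-subsets-size≤0 (f ∘ (outside ∷_)) (f-sparse ∘ (outside ∷_))) ⟩
  f ⊥ ∎
  where open ≡-Reasoning

Σ-subsets-size≤1 : ∀ {m} (f : Subset m → ℕ) → (∀ B → 2 ≤ ∣ B ∣ → f B ≡ 0) →
               Σ-subsets f ≡ f ⊥ + sum (map (λ j → f ⁅ j ⁆) (allFin m))
Σ-subsets-size≤1 {zero}  f _ = refl
Σ-subsets-size≤1 {suc m} f f-sparse = begin
  Σ-subsets f                                            ≡⟨ Σ-subsets-suc f ⟩
  Σ-subsets (f ∘ (inside ∷_)) + Σ-subsets (f ∘ (outside ∷_))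
    ≡⟨ cong₂ _+_ (Σ-subsets-size≤0 (f ∘ (inside ∷_)) (λ B → f-sparse (inside ∷ B) ∘ s≤s))
                 (Σ-subsets-size≤1 (f ∘ (outside ∷_)) (f-sparse ∘ (outside ∷_))) ⟩
  f ⁅ zero ⁆ + (f ⊥ + sum (map (λ j → f ⁅ suc j ⁆) (allFin m)))
    ≡⟨ x∙yz≈y∙xz (f ⁅ zero ⁆) (f ⊥) _ ⟩
  f ⊥ + (f ⁅ zero ⁆ + sum (map (λ j → f ⁅ suc j ⁆) (allFin m)))
    ≡⟨ cong (f ⊥ +_) (sum-allFin-suc (λ j → f ⁅ j ⁆)) ⟨
  f ⊥ + sum (map (λ j → f ⁅ j ⁆) (allFin (suc m))) ∎
  where open ≡-Reasoning

missingColor : ∀ {n d} (L : Complex n) (c : Fin n → Fin d) → ¬ ColorsAll L c →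
                ∃ λ a → ∀ v → v ∈Vert L → c v ≢ a
missingColor L c ¬all = decide (any? (λ a → all? (λ v → ¬? (hit? v a))))
  where
  hit? : ∀ v a → Dec (v ∈Vert L × c v ≡ a)
  hit? v a = (L ⁅ v ⁆ Bool.≟ true) ×-dec (c v Fin.≟ a)

  decide : Dec (∃ λ a → ∀ v → ¬ (v ∈Vert L × c v ≡ a)) → ∃ λ a → ∀ v → v ∈Vert L → c v ≢ a
  decide (yes (a , miss)) = a , λ v v∈L cv≡a → miss v (v∈L , cv≡a)
  decide (no ¬miss)       = ⊥-elim (¬all λ a → decidable-stable (any? (λ v → hit? v a))
                                       λ ¬hit → ¬miss (a , λ v hit → ¬hit (v , hit)))

faceIndicator : ∀ {m} → Complex m → ℕ → Subset m → ℕ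
faceIndicator K i F = if K F ∧ (∣ F ∣ ≡ᵇ i) then 1 else 0

module ConeUnion {n k} (Δ : Complex n) (Ls : Fin k → Complex n)
                 (Ls⊆Δ : ∀ j F → F ∈ᶜ Ls j → F ∈ᶜ Δ) where

  U : Complex (n + k)
  U = coneUnion Δ Ls

  data ConeFace (A : Subset n) : Subset k → Set where
    base : A ∈ᶜ Δ → ConeFace A ⊥
    apex : ∀ j → A ∈ᶜ Ls j → ConeFace A ⁅ j ⁆

  onParts : Subset n → Subset k → Bool
  onParts A B = (Δ A ∧ subsetEq B ⊥) ∨ any (λ j → Ls j A ∧ (subsetEq B ⊥ ∨ subsetEq B ⁅ j ⁆)) (allFin k)

  U-++ : ∀ A B → U (A ++ B) ≡ onParts A B
  U-++ A B = cong₂ onParts (take-++ A B) (drop-++ A B)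

  onParts⁺ : ∀ {A B} → ConeFace A B → T (onParts A B)
  onParts⁺ (base A∈Δ) =
    from T-∨ (inj₁ (from T-∧ (from T-≡ A∈Δ , ≡⇒subsetEq refl)))
  onParts⁺ (apex j A∈L) =
    from T-∨ (inj₂ (any⁺ _ (tabulate⁺ j (from T-∧ (from T-≡ A∈L , B≡⁅j⁆)))))
    where
    B≡⁅j⁆ : T (subsetEq ⁅ j ⁆ ⊥ ∨ subsetEq ⁅ j ⁆ ⁅ j ⁆)
    B≡⁅j⁆ = from (T-∨ {subsetEq ⁅ j ⁆ ⊥}) (inj₂ (≡⇒subsetEq {X = ⁅ j ⁆} refl))

  onParts⁻ : ∀ {A B} → T (onParts A B) → ConeFace A B
  onParts⁻ {A} {B} = [ in-Δ , in-cone ∘ tabulate⁻ ∘ any⁻ _ _ ]′ ∘ to T-∨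
    where
    in-Δ : T (Δ A ∧ subsetEq B ⊥) → ConeFace A B
    in-Δ h = let A∈Δ , B≡⊥ = to T-∧ h in
      subst (ConeFace A) (sym (subsetEq⇒≡ B≡⊥)) (base (to T-≡ A∈Δ))

    in-cone : ∃ (λ j → T (Ls j A ∧ (subsetEq B ⊥ ∨ subsetEq B ⁅ j ⁆))) → ConeFace A B
    in-cone (j , h) = let A∈L , B-shape = to T-∧ h in
      [ (λ B≡⊥   → subst (ConeFace A) (sym (subsetEq⇒≡ B≡⊥)) (base (Ls⊆Δ j A (to T-≡ A∈L))))
      , (λ B≡⁅j⁆ → subst (ConeFace A) (sym (subsetEq⇒≡ B≡⁅j⁆)) (apex j (to T-≡ A∈L)))
      ]′ (to T-∨ B-shape)

  coneFace⁺ : ∀ {A B} → ConeFace A B → (A ++ B) ∈ᶜ U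
  coneFace⁺ {A} {B} face = trans (U-++ A B) (to T-≡ (onParts⁺ face))

  coneFace⁻ : ∀ {A B} → (A ++ B) ∈ᶜ U → ConeFace A B
  coneFace⁻ {A} {B} A++B∈U = onParts⁻ (from T-≡ (trans (sym (U-++ A B)) A++B∈U))

  coneFace-base : ∀ {A B} → ConeFace A B → A ∈ᶜ Δ
  coneFace-base (base A∈Δ)   = A∈Δ
  coneFace-base (apex j A∈L) = Ls⊆Δ j _ A∈L

  coneFace-apex : ∀ {A B w} → ConeFace A B → w ∈ B → A ∈ᶜ Ls w
  coneFace-apex (base _)     w∈⊥    = contradiction w∈⊥ ∉⊥
  coneFace-apex (apex j A∈L) w∈⁅j⁆ rewrite x∈⁅y⁆⇒x≡y j w∈⁅j⁆ = A∈L

  coneFace-apex-unique : ∀ {A B w w'} → ConeFace A B → w ∈ B → w' ∈ B → w ≡ w'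
  coneFace-apex-unique (base _)   w∈⊥ _     = contradiction w∈⊥ ∉⊥
  coneFace-apex-unique (apex j _) w∈  w'∈   = trans (x∈⁅y⁆⇒x≡y j w∈) (sym (x∈⁅y⁆⇒x≡y j w'∈))

  coneFace-∣apex∣≤1 : ∀ {A B} → ConeFace A B → ∣ B ∣ ≤ 1
  coneFace-∣apex∣≤1 (base _)   = subst (_≤ 1) (sym (∣⊥∣≡0 k)) z≤n
  coneFace-∣apex∣≤1 (apex j _) = subst (_≤ 1) (sym (∣⁅x⁆∣≡1 j)) ≤-refl

  coneFace-⊆ : IsSimplicialComplex Δ → (∀ j → IsSimplicialComplex (Ls j)) →
               ∀ {A A' B B'} → ConeFace A B → A' ⊆ A → B' ⊆ B → ConeFace A' B'
  coneFace-⊆ (_ , Δ-closed) _ {A} {A'} (base A∈Δ) A'⊆A B'⊆⊥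
    rewrite ⊆⊥⇒≡⊥ B'⊆⊥ = base (Δ-closed A A' A'⊆A A∈Δ)
  coneFace-⊆ _ Ls-sc {A} {A'} (apex j A∈L) A'⊆A B'⊆⁅j⁆
    with A'∈L ← proj₂ (Ls-sc j) A A' A'⊆A A∈L | ⊆⁅x⁆⇒≡⊥⊎≡⁅x⁆ j B'⊆⁅j⁆
  ... | inj₁ refl = base (Ls⊆Δ j A' A'∈L)
  ... | inj₂ refl = apex j A'∈L

  isSimplicialComplex : IsSimplicialComplex Δ → (∀ j → IsSimplicialComplex (Ls j)) →
                        IsSimplicialComplex U
  isSimplicialComplex Δ-sc Ls-sc =
    subst (_∈ᶜ U) (⊥++⊥ n) (coneFace⁺ (base (proj₁ Δ-sc))) ,
    ∀-++ {n} (λ F → ∀ G → G ⊆ F → F ∈ᶜ U → G ∈ᶜ U) λ A B →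
    ∀-++ {n} (λ G → G ⊆ A ++ B → (A ++ B) ∈ᶜ U → G ∈ᶜ U) λ A' B' G⊆F F∈U →
    let A'⊆A , B'⊆B = ⊆-++⁻ {A' = A'} {A} {B'} {B} G⊆F in
    coneFace⁺ (coneFace-⊆ Δ-sc Ls-sc (coneFace⁻ {A} {B} F∈U) A'⊆A B'⊆B)

  dimension : ∀ {d} → DimEqDMinus1 Δ d → (∀ j → DimAtMostDMinus2 (Ls j) d) → DimEqDMinus1 U d
  dimension {d} (Δ-bound , F , F∈Δ , ∣F∣≡d) Ls-bound =
    ∀-++ {n} (λ G → G ∈ᶜ U → ∣ G ∣ ≤ d) (λ A B → bounded ∘ coneFace⁻ {A} {B}) ,
    F ++ ⊥ , coneFace⁺ (base F∈Δ) , trans (∣++⊥∣ F) ∣F∣≡d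
    where
    bounded : ∀ {A B} → ConeFace A B → ∣ A ++ B ∣ ≤ d
    bounded {A} (base A∈Δ)   = subst (_≤ d) (sym (∣++⊥∣ A)) (Δ-bound A A∈Δ)
    bounded {A} (apex j A∈L) = subst (_≤ d) (sym (∣++⁅⁆∣ A j)) (Ls-bound j A A∈L)

  isProperColoring : ∀ {d} {c : Fin n → Fin d} → IsProperColoring Δ c →
                     (∀ j → IsSimplicialComplex (Ls j)) →
                     (col : Fin k → Fin d) → (∀ j v → v ∈Vert Ls j → c v ≢ col j) →
                     IsProperColoring U ([ c , col ]′ ∘ splitAt n)
  isProperColoring {c = c} c-proper Ls-sc col col-missing =
    ∀-++ {n} (λ F → F ∈ᶜ U → ∀ x y → x ∈ F → y ∈ F → _ → x ≡ y) λ A B F∈U x y x∈ y∈ cx≡cy →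
      trans (sym (join-splitAt n k x))
        (trans (cong (join n k) (proper (coneFace⁻ {A} {B} F∈U) (splitAt n x) (splitAt n y)
                                        (∈-++⁻ A B x∈) (∈-++⁻ A B y∈) cx≡cy))
               (join-splitAt n k y))
    where
    apex-color : ∀ {A B u w} → ConeFace A B → u ∈ A → w ∈ B → c u ≢ col w
    apex-color {A} {u = u} {w} face u∈ w∈ =
      col-missing w u (proj₂ (Ls-sc w) A ⁅ u ⁆ (λ v∈ → subst (_∈ A) (sym (x∈⁅y⁆⇒x≡y u v∈)) u∈)
                                               (coneFace-apex face w∈))

    proper : ∀ {A B} → ConeFace A B → ∀ s t → [ _∈ A , _∈ B ]′ s → [ _∈ A , _∈ B ]′ t →
             [ c , col ]′ s ≡ [ c , col ]′ t → s ≡ t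
    proper face (inj₁ u) (inj₁ u') u∈ u'∈ eq = cong inj₁ (c-proper _ (coneFace-base face) u u' u∈ u'∈ eq)
    proper face (inj₁ u) (inj₂ w)  u∈ w∈  eq = contradiction eq (apex-color face u∈ w∈)
    proper face (inj₂ w) (inj₁ u)  w∈ u∈  eq = contradiction (sym eq) (apex-color face u∈ w∈)
    proper face (inj₂ w) (inj₂ w') w∈ w'∈ _  = cong inj₂ (coneFace-apex-unique face w∈ w'∈)

  U-++⊥ : ∀ A → U (A ++ ⊥) ≡ Δ A
  U-++⊥ A = ⇔→≡ (mk⇔ (coneFace-base ∘ coneFace⁻) (coneFace⁺ ∘ base))

  U-++⁅⁆ : ∀ A j → U (A ++ ⁅ j ⁆) ≡ Ls j A
  U-++⁅⁆ A j = ⇔→≡ (mk⇔ (λ A++⁅j⁆∈U → coneFace-apex (coneFace⁻ A++⁅j⁆∈U) (x∈⁅x⁆ j)) (coneFace⁺ ∘ apex j))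

  U-++-∣apex∣≥2 : ∀ A B → 2 ≤ ∣ B ∣ → U (A ++ B) ≡ false
  U-++-∣apex∣≥2 A B 2≤∣B∣ = ¬-not λ A++B∈U → ≤⇒≯ (coneFace-∣apex∣≤1 (coneFace⁻ {A} {B} A++B∈U)) 2≤∣B∣

  faceIndicator-++⊥ : ∀ i A → faceIndicator U i (A ++ ⊥) ≡ faceIndicator Δ i A
  faceIndicator-++⊥ i A = cong₂ (λ b s → if b ∧ (s ≡ᵇ i) then 1 else 0) (U-++⊥ A) (∣++⊥∣ A)

  faceIndicator-++⁅⁆ : ∀ i A j → faceIndicator U i (A ++ ⁅ j ⁆) ≡ shift (λ m → faceIndicator (Ls j) m A) i
  faceIndicator-++⁅⁆ i A j =
    trans (cong₂ (λ b s → if b ∧ (s ≡ᵇ i) then 1 else 0) (U-++⁅⁆ A j) (∣++⁅⁆∣ A j)) (one-more-vertex i)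
    where
    one-more-vertex : ∀ i → (if Ls j A ∧ (suc ∣ A ∣ ≡ᵇ i) then 1 else 0) ≡ shift (λ m → faceIndicator (Ls j) m A) i
    one-more-vertex zero    = cong (λ b → if b then 1 else 0) (∧-zeroʳ (Ls j A))
    one-more-vertex (suc i) = refl

  Σ-over-apex-parts : ∀ i A → Σ-subsets (λ B → faceIndicator U i (A ++ B))
                         ≡ faceIndicator Δ i A + sum (map (λ j → shift (λ m → faceIndicator (Ls j) m A) i) (allFin k))
  Σ-over-apex-parts i A =
    trans (Σ-subsets-size≤1 _ λ B 2≤∣B∣ → cong (λ b → if b ∧ _ then 1 else 0) (U-++-∣apex∣≥2 A B 2≤∣B∣))
          (cong₂ _+_ (faceIndicator-++⊥ i A) (cong sum (map-cong (faceIndicator-++⁅⁆ i A) (allFin k))))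

  fvec-U : ∀ i → fvec U i ≡ fvec Δ i + shift (λ m → sum (map (λ j → fvec (Ls j) m) (allFin k))) i
  fvec-U i = begin
    fvec U i
      ≡⟨ Σ-subsets-++ n (faceIndicator U i) ⟩
    Σ-subsets {n} (λ A → Σ-subsets {k} (λ B → faceIndicator U i (A ++ B)))
      ≡⟨ cong sum (map-cong (Σ-over-apex-parts i) (allSubsets n)) ⟩
    Σ-subsets {n} (λ A → faceIndicator Δ i A + sum (map (λ j → cone j A) (allFin k)))
      ≡⟨ sum-map-+ (faceIndicator Δ i) _ (allSubsets n) ⟩
    fvec Δ i + Σ-subsets {n} (λ A → sum (map (λ j → cone j A) (allFin k)))
      ≡⟨ cong (fvec Δ i +_) (sum-map-swap (λ A j → cone j A) (allSubsets n) (allFin k)) ⟩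
    fvec Δ i + sum (map (λ j → Σ-subsets (cone j)) (allFin k))
      ≡⟨ cong (λ s → fvec Δ i + sum s) (map-cong (λ j → sum-map-shift _ (allSubsets n) i) (allFin k)) ⟩
    fvec Δ i + sum (map (λ j → shift (fvec (Ls j)) i) (allFin k))
      ≡⟨ cong (fvec Δ i +_) (sum-map-shift (λ j → fvec (Ls j)) (allFin k) i) ⟩
    fvec Δ i + shift (λ m → sum (map (λ j → fvec (Ls j) m) (allFin k))) i ∎
    where
    open ≡-Reasoning
    cone : Fin k → Subset n → ℕ
    cone j A = shift (λ m → faceIndicator (Ls j) m A) i

lemma3p2 : (n d k : ℕ) (Δ : Complex n) (c : Fin n → Fin d)
    → IsSimplicialComplex Δ → DimEqDMinus1 Δ d → IsProperColoring Δ c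
    → (Ls : Fin k → Complex n)
    → (∀ (j : Fin k) → IsSubcomplex (Ls j) Δ)
    → (∀ (j : Fin k) → DimAtMostDMinus2 (Ls j) d)
    → (∀ (j : Fin k) → ¬ ColorsAll (Ls j) c)
    → IsBalanced (coneUnion Δ Ls) d
      × (∀ (i : ℕ) → fvec (coneUnion Δ Ls) i
           ≡ fvec Δ i + shift (λ m → sum (map (λ j → fvec (Ls j) m) (allFin k))) i)
lemma3p2 n d k Δ c Δ-sc Δ-dim c-proper Ls Ls-sub Ls-dim Ls-miss =
  ( isSimplicialComplex Δ-sc Ls-sc
  , dimension Δ-dim Ls-dim
  , [ c , col ]′ ∘ splitAt n
  , isProperColoring c-proper Ls-sc col (λ j → proj₂ (missingColor (Ls j) c (Ls-miss j))) )
  , fvec-U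
  where
  open ConeUnion Δ Ls (λ j → proj₂ (Ls-sub j))

  Ls-sc : ∀ j → IsSimplicialComplex (Ls j)
  Ls-sc j = proj₁ (Ls-sub j)

  col : Fin k → Fin d
  col j = proj₁ (missingColor (Ls j) c (Ls-miss j))
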